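{- Let $h\ge 4$ and let $G$ be a graph with $\chi(G)=\Gamma(G)=3$, $\psi(G)=h$ and exactly $2h-2$ vertices. Let $\mathcal H$ be a complete $h$-coloring of $G$ having exactly two singleton color classes $\{\phi_1\}$, $\{\phi_2\}$, all other color classes (called pairs) $M_1,\dots,M_{h-2}$ having exactly two vertices, and let $M=M_1\cup\dots\cup M_{h-2}$. If a pair $M_i$ contains no vertex that is isolated in the induced subgraph $G[M]$, then the subgraph of $G$ induced by $M_i\cup\{\phi_1,\phi_2\}$ is isomorphic to the path $P_4$.
   Context: A complete $k$-coloring of a graph is a proper coloring with exactly $k$ colors in which any two color classes are joined by at least one edge; $\psi$ (achromatic number) is the maximum such $k$, $\chi$ is the chromatic number. A Grundy coloring is a proper coloring $\varphi:V\to\{1,\dots,k\}$ in which every vertex $v$ has a neighbor of color $i$ for every $1\le i<\varphi(v)$; the Grundy number $\Gamma$ is the maximum $k$ for which such a coloring exists. -}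

module Defs where

open import Data.Nat using (ℕ; suc; _<_)
open import Data.Fin using (Fin; toℕ)
open import Data.Product using (Σ; ∃; ∃-syntax; _×_; _,_)
open import Data.Sum using (_⊎_)
open import Relation.Nullary using (¬_)
open import Relation.Binary using (Decidable)
open import Relation.Binary.PropositionalEquality using (_≡_; _≢_)
open import Function.Bundles using (_⇔_)
open import Function.Definitions using (Injective)

record Graph (n : ℕ) : Set₁ where
  field
    Adj   : Fin n → Fin n → Set
    sym   : ∀ {u v} → Adj u v → Adj v u
    irrefl : ∀ {v} → ¬ Adj v v
    adj?  : Decidable Adj
open Graph public

module _ {n : ℕ} (G : Graph n) where

  IsProper : {k : ℕ} → (Fin n → Fin k) → Set
  IsProper c = ∀ {u v} → Adj G u v → c u ≢ c v

  IsExactColoring : (k : ℕ) → (Fin n → Fin k) → Set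
  IsExactColoring k c = IsProper c × (∀ i → ∃[ v ] c v ≡ i)

  Colorable : ℕ → Set
  Colorable k = Σ (Fin n → Fin k) IsProper

  ChromaticNumber : ℕ → Set
  ChromaticNumber k = Colorable k × (∀ m → m < k → ¬ Colorable m)

  IsComplete : (k : ℕ) → (Fin n → Fin k) → Set
  IsComplete k c = IsExactColoring k c ×
    (∀ i j → i ≢ j → ∃[ u ] ∃[ v ] (c u ≡ i × c v ≡ j × Adj G u v))

  HasComplete : ℕ → Set
  HasComplete k = Σ (Fin n → Fin k) (IsComplete k)

  AchromaticNumber : ℕ → Set
  AchromaticNumber k = HasComplete k × (∀ m → k < m → ¬ HasComplete m)

  -- Grundy coloring with exactly k colors (colors 1..k encoded as Fin k,
  -- i.e. 0..k-1): every vertex v has a neighbour of every color below c v.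
  IsGrundy : (k : ℕ) → (Fin n → Fin k) → Set
  IsGrundy k c = IsExactColoring k c ×
    (∀ v (i : Fin k) → toℕ i < toℕ (c v) → ∃[ u ] (Adj G v u × c u ≡ i))

  HasGrundy : ℕ → Set
  HasGrundy k = Σ (Fin n → Fin k) (IsGrundy k)

  GrundyNumber : ℕ → Set
  GrundyNumber k = HasGrundy k × (∀ m → k < m → ¬ HasGrundy m)

  InducedP4 : (S : Fin n → Set) → Set
  InducedP4 S = Σ (Fin 4 → Fin n) λ g →
    Injective _≡_ _≡_ g ×
    (∀ i → S (g i)) ×
    (∀ v → S v → ∃[ i ] g i ≡ v) ×
    (∀ i j → Adj G (g i) (g j) ⇔ P4Adj i j)
    where
    P4Adj : Fin 4 → Fin 4 → Set
    P4Adj i j = suc (toℕ i) ≡ toℕ j ⊎ suc (toℕ j) ≡ toℕ i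

module Submission where

-- (1) In a complete colouring a singleton vertex has a neighbour in every
--     other class; in particular φ₁φ₂ is an edge.
-- (2) If Γ(G) = 3, no vertex x is adjacent to φ₁, φ₂ and a third vertex
--     y ∉ {φ₁, φ₂}: giving the class of y colour 0, φ₁ colour 1, φ₂ colour 2
--     and x colour 3 is a partial Grundy colouring, and every partial Grundy
--     colouring extends greedily to a Grundy colouring, so Γ(G) ≥ 4.
-- (3) Hence φ₁ and φ₂ have distinct neighbours w₁, w₂ in class i, the class
--     is {w₁, w₂}, and w₁ φ₁ φ₂ w₂ is an induced path P₄.

open import Defs hiding (sym)
open import Data.Bool using (if_then_else_)
open import Data.Nat using (ℕ; suc; _≤_; _<_; _∸_; _*_; s≤s)
open import Data.Nat.Properties using (≤-pred; ≮⇒≥; <-≤-trans; <-irrefl; m≤n⇒m<n∨m≡n; 1+n≰n)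
  renaming (_≟_ to _≟ℕ_)
open import Data.Fin using (Fin; toℕ; fromℕ; fromℕ<; inject)
open import Data.Fin.Patterns using (0F; 1F; 2F; 3F)
open import Data.Fin.Properties using (_≟_; any?; toℕ<n; toℕ-injective; toℕ-fromℕ; toℕ-fromℕ<; toℕ-inject; ¬∀⟶∃¬-smallest)
open import Data.Maybe using (Maybe; just; nothing; fromMaybe)
open import Data.Maybe.Properties using (just-injective) renaming (≡-dec to ≡-dec-Maybe)
open import Data.List using (List; []; _∷_; allFin)
open import Data.List.Relation.Unary.All using (All; []; _∷_; lookup)
open import Data.List.Membership.Propositional.Properties using (∈-allFin)
open import Data.List.Extrema.Nat using (argmax; f[xs]≤f[argmax])
open import Data.Vec.Functional using (updateAt)
open import Data.Vec.Functional.Properties using (updateAt-updates; updateAt-minimal)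
open import Data.Product using (_×_; ∃-syntax; _,_; proj₁; proj₂)
open import Data.Sum using (_⊎_; inj₁; inj₂)
open import Data.Empty using (⊥)
open import Function using (_∘_; const)
open import Function.Bundles using (_⇔_; mk⇔)
open import Relation.Nullary using (¬_; Dec; yes; no; contradiction)
open import Relation.Nullary.Decidable using (_×-dec_; does; dec-true; dec-false)
open import Relation.Binary.PropositionalEquality using (_≡_; _≢_; refl; sym; trans; cong; subst)

maximum : ∀ {n} (g : Fin n → ℕ) → Fin n → ∃[ w ] (∀ v → g v ≤ g w)
maximum g v₀ = argmax g v₀ (allFin _) , λ v → lookup (f[xs]≤f[argmax] v₀ (allFin _)) (∈-allFin v)

AtMostTwo : ∀ {A : Set} → (A → Set) → Set
AtMostTwo P = ∀ {u v w} → P u → P v → P w → u ≡ v ⊎ u ≡ w ⊎ v ≡ w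

atMostTwo : ∀ {A : Set} {P : A → Set} (a b : A) → (∀ u → P u → u ≡ a ⊎ u ≡ b) → AtMostTwo P
atMostTwo a b inAB {u} {v} {w} Pu Pv Pw with inAB u Pu | inAB v Pv | inAB w Pw
... | inj₁ u≡a | inj₁ v≡a | _        = inj₁ (trans u≡a (sym v≡a))
... | inj₂ u≡b | inj₂ v≡b | _        = inj₁ (trans u≡b (sym v≡b))
... | inj₁ u≡a | inj₂ _   | inj₁ w≡a = inj₂ (inj₁ (trans u≡a (sym w≡a)))
... | inj₂ u≡b | inj₁ _   | inj₂ w≡b = inj₂ (inj₁ (trans u≡b (sym w≡b)))
... | inj₁ _   | inj₂ v≡b | inj₂ w≡b = inj₂ (inj₂ (trans v≡b (sym w≡b)))
... | inj₂ _   | inj₁ v≡a | inj₁ w≡a = inj₂ (inj₂ (trans v≡a (sym w≡a)))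

module GreedyExtension {n : ℕ} (G : Graph n) where

  PartialColouring : Set
  PartialColouring = Fin n → Maybe ℕ

  Coloured : PartialColouring → Fin n → Set
  Coloured f v = ∃[ a ] f v ≡ just a

  SeesColour : PartialColouring → Fin n → ℕ → Set
  SeesColour f v a = ∃[ u ] (Adj G v u × f u ≡ just a)

  seesColour? : ∀ f v a → Dec (SeesColour f v a)
  seesColour? f v a = any? λ u → adj? G v u ×-dec ≡-dec-Maybe _≟ℕ_ (f u) (just a)

  record IsPartialGrundy (f : PartialColouring) : Set where
    field
      proper : ∀ {u v a} → Adj G u v → f u ≡ just a → f v ≡ just a → ⊥
      grundy : ∀ {v a} → f v ≡ just a → ∀ i → i < a → SeesColour f v i
  open IsPartialGrundy

  _⊑_ : PartialColouring → PartialColouring → Set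
  f ⊑ f' = ∀ {w a} → f w ≡ just a → f' w ≡ just a

  seesColour-⊑ : ∀ {f f' v a} → f ⊑ f' → SeesColour f v a → SeesColour f' v a
  seesColour-⊑ f⊑f' (u , v~u , fu) = u , v~u , f⊑f' fu

  -- The least colour not seen by v (it exists since colours are bounded);
  -- this is the colour the greedy algorithm gives v.
  leastFreeColour : ∀ f v → ∃[ a ] (¬ SeesColour f v a × (∀ i → i < a → SeesColour f v i))
  leastFreeColour f v with ¬∀⟶∃¬-smallest _ (SeesColour f v ∘ toℕ) (seesColour? f v ∘ toℕ) topUnseen
    where
    colourOf : Fin n → ℕ
    colourOf u = fromMaybe 0 (f u)
    top : ℕ
    top = colourOf (proj₁ (maximum colourOf v))
    topUnseen : ¬ (∀ (j : Fin (suc (suc top))) → SeesColour f v (toℕ j))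
    topUnseen sees with subst (SeesColour f v) (toℕ-fromℕ (suc top)) (sees (fromℕ (suc top)))
    ... | u , _ , fu = 1+n≰n (subst (_≤ top) (cong (fromMaybe 0) fu) (proj₂ (maximum colourOf v) u))
  ... | a , free , below = toℕ a , free , seesBelow
    where
    seesBelow : ∀ i → i < toℕ a → SeesColour f v i
    seesBelow i i<a = subst (SeesColour f v) (trans (toℕ-inject (fromℕ< i<a)) (toℕ-fromℕ< i<a)) (below (fromℕ< i<a))

  colourVertex : ∀ {f} → IsPartialGrundy f → ∀ v →
                 ∃[ f' ] (IsPartialGrundy f' × f ⊑ f' × Coloured f' v)
  colourVertex {f} isPG v with f v in fv
  ... | just a = f , isPG , (λ e → e) , a , fv
  ... | nothing with leastFreeColour f v
  ...   | a , free , below = f' , isPG' , extends , a , updateAt-updates v f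
    where
    f' : PartialColouring
    f' = updateAt f v (const (just a))

    recoloured : ∀ {w b} → f' w ≡ just b → (w ≡ v × b ≡ a) ⊎ (w ≢ v × f w ≡ just b)
    recoloured {w} f'w with w ≟ v
    ... | yes refl = inj₁ (refl , just-injective (trans (sym f'w) (updateAt-updates v f)))
    ... | no w≢v = inj₂ (w≢v , trans (sym (updateAt-minimal w v f w≢v)) f'w)

    extends : f ⊑ f'
    extends {w} fw with w ≟ v
    ... | yes refl = contradiction (trans (sym fv) fw) λ ()
    ... | no w≢v = trans (updateAt-minimal w v f w≢v) fw

    isPG' : IsPartialGrundy f'
    proper isPG' u~w f'u f'w with recoloured f'u | recoloured f'w
    ... | inj₁ (refl , _) | inj₁ (refl , _) = irrefl G u~w
    ... | inj₁ (refl , refl) | inj₂ (_ , fw) = free (_ , u~w , fw)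
    ... | inj₂ (_ , fu) | inj₁ (refl , refl) = free (_ , Graph.sym G u~w , fu)
    ... | inj₂ (_ , fu) | inj₂ (_ , fw) = proper isPG u~w fu fw
    grundy isPG' f'w i i<b with recoloured f'w
    ... | inj₁ (refl , refl) = seesColour-⊑ extends (below i i<b)
    ... | inj₂ (_ , fw) = seesColour-⊑ extends (grundy isPG fw i i<b)

  colourAll : ∀ (vs : List (Fin n)) {f} → IsPartialGrundy f →
              ∃[ f' ] (IsPartialGrundy f' × f ⊑ f' × All (Coloured f') vs)
  colourAll [] {f} isPG = f , isPG , (λ e → e) , []
  colourAll (v ∷ vs) isPG with colourVertex isPG v
  ... | f₁ , isPG₁ , f⊑f₁ , (a , f₁v) with colourAll vs isPG₁
  ...   | f' , isPG' , f₁⊑f' , colouredVs = f' , isPG' , (λ e → f₁⊑f' (f⊑f₁ e)) , (a , f₁⊑f' f₁v) ∷ colouredVs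

  completion : ∀ {f} → IsPartialGrundy f →
               ∃[ f' ] (IsPartialGrundy f' × f ⊑ f' × (∀ v → Coloured f' v))
  completion isPG with colourAll (allFin n) isPG
  ... | f' , isPG' , f⊑f' , colouredAll = f' , isPG' , f⊑f' , λ v → lookup colouredAll (∈-allFin v)

  -- A total partial Grundy colouring whose largest colour is M is a Grundy
  -- colouring with exactly M + 1 colours (the maximum vertex sees all smaller
  -- colours, so every colour is used).
  totalGrundy : ∀ {f} → IsPartialGrundy f → (∀ v → Coloured f v) → Fin n →
                ∃[ m ] ((∀ {v a} → f v ≡ just a → a < m) × HasGrundy G m)
  totalGrundy {f} isPG total v₀ = suc (g w) , bound , c , (proper' , onto) , grundy'
    where
    g : Fin n → ℕ
    g v = proj₁ (total v)
    colour-g : ∀ {v a} → f v ≡ just a → g v ≡ a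
    colour-g {v} fv = just-injective (trans (sym (proj₂ (total v))) fv)
    w : Fin n
    w = proj₁ (maximum g v₀)
    bound : ∀ {v a} → f v ≡ just a → a < suc (g w)
    bound {v} fv = s≤s (subst (_≤ g w) (colour-g fv) (proj₂ (maximum g v₀) v))
    c : Fin n → Fin (suc (g w))
    c v = fromℕ< (s≤s (proj₂ (maximum g v₀) v))
    c-from-g : ∀ {v} {i : Fin (suc (g w))} → g v ≡ toℕ i → c v ≡ i
    c-from-g e = toℕ-injective (trans (toℕ-fromℕ< _) e)
    g-from-c : ∀ {u v} → c u ≡ c v → g u ≡ g v
    g-from-c cu≡cv = trans (sym (toℕ-fromℕ< _)) (trans (cong toℕ cu≡cv) (toℕ-fromℕ< _))
    sees : ∀ {v} i → i < g v → ∃[ u ] (Adj G v u × g u ≡ i)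
    sees {v} i i<gv with grundy isPG (proj₂ (total v)) i i<gv
    ... | u , v~u , fu = u , v~u , colour-g fu
    proper' : IsProper G c
    proper' u~v cu≡cv = proper isPG u~v (proj₂ (total _)) (trans (proj₂ (total _)) (cong just (sym (g-from-c cu≡cv))))
    onto : ∀ i → ∃[ v ] c v ≡ i
    onto i with m≤n⇒m<n∨m≡n (≤-pred (toℕ<n i))
    ... | inj₂ i≡max = w , c-from-g (sym i≡max)
    ... | inj₁ i<max with sees (toℕ i) i<max
    ...   | u , _ , gu = u , c-from-g gu
    grundy' : ∀ v (i : Fin (suc (g w))) → toℕ i < toℕ (c v) → ∃[ u ] (Adj G v u × c u ≡ i)
    grundy' v i i<cv with sees (toℕ i) (subst (toℕ i <_) (toℕ-fromℕ< _) i<cv)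
    ... | u , v~u , gu = u , v~u , c-from-g gu

  partialGrundyBound : ∀ {k f} → GrundyNumber G k → IsPartialGrundy f →
                       ∀ {x a} → f x ≡ just a → a < k
  partialGrundyBound (_ , noLarger) isPG {x} fx with completion isPG
  ... | f' , isPG' , f⊑f' , total with totalGrundy isPG' total x
  ...   | m , below , hasGrundy = <-≤-trans (below (f⊑f' fx)) (≮⇒≥ λ k<m → noLarger _ k<m hasGrundy)

edge : ∀ {A B : Set} → A → B → A ⇔ B
edge a b = mk⇔ (const b) (const a)

nonEdge : ∀ {A B : Set} → ¬ A → ¬ B → A ⇔ B
nonEdge ¬a ¬b = mk⇔ (λ a → contradiction a ¬a) (λ b → contradiction b ¬b)

module InducedPath {n : ℕ} (G : Graph n) where

  PathEdge : Fin 4 → Fin 4 → Set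
  PathEdge i j = suc (toℕ i) ≡ toℕ j ⊎ suc (toℕ j) ≡ toℕ i

  adj⇒≢ : ∀ {u v} → Adj G u v → u ≢ v
  adj⇒≢ u~v refl = irrefl G u~v

  inducedPath : (S : Fin n → Set) (p q r s : Fin n) →
    Adj G p q → Adj G q r → Adj G r s →
    ¬ Adj G p r → ¬ Adj G q s → ¬ Adj G p s →
    p ≢ r → q ≢ s → p ≢ s →
    S p → S q → S r → S s → (∀ v → S v → v ≡ p ⊎ v ≡ q ⊎ v ≡ r ⊎ v ≡ s) →
    InducedP4 G S
  inducedPath S p q r s pq qr rs ¬pr ¬qs ¬ps p≢r q≢s p≢s Sp Sq Sr Ss onlyPQRS =
    path , injective , inS , covers , adjacency
    where
    path : Fin 4 → Fin n
    path 0F = p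
    path 1F = q
    path 2F = r
    path 3F = s

    p≢q : p ≢ q
    p≢q = adj⇒≢ pq
    q≢r : q ≢ r
    q≢r = adj⇒≢ qr
    r≢s : r ≢ s
    r≢s = adj⇒≢ rs

    injective : ∀ {i j} → path i ≡ path j → i ≡ j
    injective {0F} {0F} _ = refl
    injective {0F} {1F} e = contradiction e p≢q
    injective {0F} {2F} e = contradiction e p≢r
    injective {0F} {3F} e = contradiction e p≢s
    injective {1F} {0F} e = contradiction (sym e) p≢q
    injective {1F} {1F} _ = refl
    injective {1F} {2F} e = contradiction e q≢r
    injective {1F} {3F} e = contradiction e q≢s
    injective {2F} {0F} e = contradiction (sym e) p≢r
    injective {2F} {1F} e = contradiction (sym e) q≢r
    injective {2F} {2F} _ = refl
    injective {2F} {3F} e = contradiction e r≢s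
    injective {3F} {0F} e = contradiction (sym e) p≢s
    injective {3F} {1F} e = contradiction (sym e) q≢s
    injective {3F} {2F} e = contradiction (sym e) r≢s
    injective {3F} {3F} _ = refl

    inS : ∀ i → S (path i)
    inS 0F = Sp
    inS 1F = Sq
    inS 2F = Sr
    inS 3F = Ss

    covers : ∀ v → S v → ∃[ i ] path i ≡ v
    covers v Sv with onlyPQRS v Sv
    ... | inj₁ refl = 0F , refl
    ... | inj₂ (inj₁ refl) = 1F , refl
    ... | inj₂ (inj₂ (inj₁ refl)) = 2F , refl
    ... | inj₂ (inj₂ (inj₂ refl)) = 3F , refl

    adjacency : ∀ i j → Adj G (path i) (path j) ⇔ PathEdge i j
    adjacency 0F 0F = nonEdge (irrefl G) λ { (inj₁ ()) ; (inj₂ ()) }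
    adjacency 0F 1F = edge pq (inj₁ refl)
    adjacency 0F 2F = nonEdge ¬pr λ { (inj₁ ()) ; (inj₂ ()) }
    adjacency 0F 3F = nonEdge ¬ps λ { (inj₁ ()) ; (inj₂ ()) }
    adjacency 1F 0F = edge (Graph.sym G pq) (inj₂ refl)
    adjacency 1F 1F = nonEdge (irrefl G) λ { (inj₁ ()) ; (inj₂ ()) }
    adjacency 1F 2F = edge qr (inj₁ refl)
    adjacency 1F 3F = nonEdge ¬qs λ { (inj₁ ()) ; (inj₂ ()) }
    adjacency 2F 0F = nonEdge (¬pr ∘ Graph.sym G) λ { (inj₁ ()) ; (inj₂ ()) }
    adjacency 2F 1F = edge (Graph.sym G qr) (inj₂ refl)
    adjacency 2F 2F = nonEdge (irrefl G) λ { (inj₁ ()) ; (inj₂ ()) }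
    adjacency 2F 3F = edge rs (inj₁ refl)
    adjacency 3F 0F = nonEdge (¬ps ∘ Graph.sym G) λ { (inj₁ ()) ; (inj₂ ()) }
    adjacency 3F 1F = nonEdge (¬qs ∘ Graph.sym G) λ { (inj₁ ()) ; (inj₂ ()) }
    adjacency 3F 2F = edge (Graph.sym G rs) (inj₂ refl)
    adjacency 3F 3F = nonEdge (irrefl G) λ { (inj₁ ()) ; (inj₂ ()) }

module SingletonClasses {n h : ℕ} (G : Graph n) (c : Fin n → Fin h) (complete : IsComplete G h c) where
  open GreedyExtension G
  open InducedPath G

  properColouring : IsProper G c
  properColouring = proj₁ (proj₁ complete)

  Singleton : Fin n → Set
  Singleton φ = ∀ v → c v ≡ c φ → v ≡ φ

  singletonSeesClass : ∀ {φ} → Singleton φ → ∀ k → k ≢ c φ → ∃[ w ] (c w ≡ k × Adj G φ w)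
  singletonSeesClass {φ} single k k≢cφ with proj₂ complete (c φ) k (k≢cφ ∘ sym)
  ... | u , w , cu , cw , u~w = w , cw , subst (λ z → Adj G z w) (single u cu) u~w

  singletonsAdjacent : ∀ {φ₁ φ₂} → Singleton φ₁ → Singleton φ₂ → φ₁ ≢ φ₂ → Adj G φ₁ φ₂
  singletonsAdjacent {φ₁} {φ₂} single₁ single₂ φ₁≢φ₂
    with singletonSeesClass single₁ (c φ₂) (φ₁≢φ₂ ∘ sym ∘ single₁ φ₂)
  ... | w , cw , φ₁~w = subst (Adj G φ₁) (single₂ w cw) φ₁~w

  module TwoSingletons (grundy3 : GrundyNumber G 3) {φ₁ φ₂ : Fin n}
    (single₁ : Singleton φ₁) (single₂ : Singleton φ₂) (φ₁≢φ₂ : φ₁ ≢ φ₂) where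

    φ₁~φ₂ : Adj G φ₁ φ₂
    φ₁~φ₂ = singletonsAdjacent single₁ single₂ φ₁≢φ₂

    module FourLayers (x y : Fin n) (y≢φ₁ : y ≢ φ₁) (y≢φ₂ : y ≢ φ₂)
                      (x~y : Adj G x y) (x~φ₁ : Adj G x φ₁) (x~φ₂ : Adj G x φ₂) where

      layers : PartialColouring
      layers v = if does (v ≟ x) then just 3 else
                 if does (v ≟ φ₂) then just 2 else
                 if does (v ≟ φ₁) then just 1 else
                 if does (c v ≟ c y) then just 0 else nothing

      data Layer : Fin n → ℕ → Set where
        classOfY : ∀ {v} → c v ≡ c y → Layer v 0
        first    : Layer φ₁ 1
        second   : Layer φ₂ 2
        apex     : Layer x 3

      layerOf : ∀ {v a} → layers v ≡ just a → Layer v a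
      layerOf {v} e with v ≟ x
      ... | yes refl = subst (Layer x) (just-injective e) apex
      ... | no _ with v ≟ φ₂
      ...   | yes refl = subst (Layer φ₂) (just-injective e) second
      ...   | no _ with v ≟ φ₁
      ...     | yes refl = subst (Layer φ₁) (just-injective e) first
      ...     | no _ with c v ≟ c y
      ...       | yes cv = subst (Layer v) (just-injective e) (classOfY cv)
      ...       | no _ = contradiction e λ ()

      x≢φ₁ : x ≢ φ₁
      x≢φ₁ = adj⇒≢ x~φ₁
      x≢φ₂ : x ≢ φ₂
      x≢φ₂ = adj⇒≢ x~φ₂

      layered : ∀ {v a} → Layer v a → layers v ≡ just a
      layered apex rewrite dec-true (x ≟ x) refl = refl
      layered second rewrite dec-false (φ₂ ≟ x) (x≢φ₂ ∘ sym) | dec-true (φ₂ ≟ φ₂) refl = refl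
      layered first rewrite dec-false (φ₁ ≟ x) (x≢φ₁ ∘ sym) | dec-false (φ₁ ≟ φ₂) φ₁≢φ₂
                          | dec-true (φ₁ ≟ φ₁) refl = refl
      layered (classOfY {v} cv)
        rewrite dec-false (v ≟ x) (λ { refl → properColouring x~y cv })
              | dec-false (v ≟ φ₂) (λ { refl → y≢φ₂ (single₂ y (sym cv)) })
              | dec-false (v ≟ φ₁) (λ { refl → y≢φ₁ (single₁ y (sym cv)) })
              | dec-true (c v ≟ c y) cv = refl

      seesClassOfY : ∀ {φ} → Singleton φ → y ≢ φ → SeesColour layers φ 0
      seesClassOfY {φ} single y≢φ with singletonSeesClass single (c y) (y≢φ ∘ single y)
      ... | w , cw , φ~w = w , φ~w , layered (classOfY cw)

      layersProper : ∀ {u v a} → Adj G u v → Layer u a → Layer v a → ⊥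
      layersProper u~v (classOfY cu) (classOfY cv) = properColouring u~v (trans cu (sym cv))
      layersProper u~v first first = irrefl G u~v
      layersProper u~v second second = irrefl G u~v
      layersProper u~v apex apex = irrefl G u~v

      layersGrundy : ∀ {v a} → Layer v a → ∀ i → i < a → SeesColour layers v i
      layersGrundy (classOfY _) _ ()
      layersGrundy first 0 _ = seesClassOfY single₁ y≢φ₁
      layersGrundy second 0 _ = seesClassOfY single₂ y≢φ₂
      layersGrundy second 1 _ = φ₁ , Graph.sym G φ₁~φ₂ , layered first
      layersGrundy apex 0 _ = y , x~y , layered (classOfY refl)
      layersGrundy apex 1 _ = φ₁ , x~φ₁ , layered first
      layersGrundy apex 2 _ = φ₂ , x~φ₂ , layered second
      layersGrundy first (suc _) (s≤s ())
      layersGrundy second (suc (suc _)) (s≤s (s≤s ()))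
      layersGrundy apex (suc (suc (suc _))) (s≤s (s≤s (s≤s ())))

      layersPartialGrundy : IsPartialGrundy layers
      layersPartialGrundy = record
        { proper = λ u~v eu ev → layersProper u~v (layerOf eu) (layerOf ev)
        ; grundy = λ e → layersGrundy (layerOf e)
        }

      fourColours : ⊥
      fourColours = <-irrefl refl (partialGrundyBound grundy3 layersPartialGrundy {x} (layered apex))

    commonNeighbourHasNoOtherNeighbour : ∀ x y → y ≢ φ₁ → y ≢ φ₂ →
      Adj G x y → Adj G x φ₁ → Adj G x φ₂ → ⊥
    commonNeighbourHasNoOtherNeighbour = FourLayers.fourColours

    pairClassInducesP4 : ∀ i → i ≢ c φ₁ → i ≢ c φ₂ → AtMostTwo (λ v → c v ≡ i) →
      (∀ v → c v ≡ i → ∃[ u ] (u ≢ φ₁ × u ≢ φ₂ × Adj G v u)) →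
      InducedP4 G (λ v → c v ≡ i ⊎ v ≡ φ₁ ⊎ v ≡ φ₂)
    pairClassInducesP4 i i≢cφ₁ i≢cφ₂ classAtMostTwo hasOtherNeighbour
      with singletonSeesClass single₁ i i≢cφ₁ | singletonSeesClass single₂ i i≢cφ₂
    ... | w₁ , cw₁ , φ₁~w₁ | w₂ , cw₂ , φ₂~w₂ =
      inducedPath _ w₁ φ₁ φ₂ w₂ (Graph.sym G φ₁~w₁) φ₁~φ₂ φ₂~w₂
        w₁≁φ₂ φ₁≁w₂ w₁≁w₂ w₁≢φ₂ φ₁≢w₂ w₁≢w₂
        (inj₁ cw₁) (inj₂ (inj₁ refl)) (inj₂ (inj₂ refl)) (inj₁ cw₂) onlyPath
      where
      notBothSingletons : ∀ {v} → c v ≡ i → Adj G v φ₁ → Adj G v φ₂ → ⊥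
      notBothSingletons {v} cv v~φ₁ v~φ₂ with hasOtherNeighbour v cv
      ... | u , u≢φ₁ , u≢φ₂ , v~u = commonNeighbourHasNoOtherNeighbour v u u≢φ₁ u≢φ₂ v~u v~φ₁ v~φ₂

      w₁≁φ₂ : ¬ Adj G w₁ φ₂
      w₁≁φ₂ = notBothSingletons cw₁ (Graph.sym G φ₁~w₁)
      φ₁≁w₂ : ¬ Adj G φ₁ w₂
      φ₁≁w₂ φ₁~w₂ = notBothSingletons cw₂ (Graph.sym G φ₁~w₂) (Graph.sym G φ₂~w₂)
      w₁≁w₂ : ¬ Adj G w₁ w₂
      w₁≁w₂ w₁~w₂ = properColouring w₁~w₂ (trans cw₁ (sym cw₂))
      w₁≢φ₂ : w₁ ≢ φ₂
      w₁≢φ₂ refl = i≢cφ₂ (sym cw₁)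
      φ₁≢w₂ : φ₁ ≢ w₂
      φ₁≢w₂ refl = i≢cφ₁ (sym cw₂)
      w₁≢w₂ : w₁ ≢ w₂
      w₁≢w₂ refl = notBothSingletons cw₁ (Graph.sym G φ₁~w₁) (Graph.sym G φ₂~w₂)

      onlyPath : ∀ v → c v ≡ i ⊎ v ≡ φ₁ ⊎ v ≡ φ₂ → v ≡ w₁ ⊎ v ≡ φ₁ ⊎ v ≡ φ₂ ⊎ v ≡ w₂
      onlyPath v (inj₁ cv) with classAtMostTwo cv cw₁ cw₂
      ... | inj₁ v≡w₁ = inj₁ v≡w₁
      ... | inj₂ (inj₁ v≡w₂) = inj₂ (inj₂ (inj₂ v≡w₂))
      ... | inj₂ (inj₂ w₁≡w₂) = contradiction w₁≡w₂ w₁≢w₂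
      onlyPath v (inj₂ (inj₁ v≡φ₁)) = inj₂ (inj₁ v≡φ₁)
      onlyPath v (inj₂ (inj₂ v≡φ₂)) = inj₂ (inj₂ (inj₁ v≡φ₂))

corollary1 : (h : ℕ) → 4 ≤ h → (G : Graph (2 * h ∸ 2)) →
    ChromaticNumber G 3 → GrundyNumber G 3 → AchromaticNumber G h →
    (c : Fin (2 * h ∸ 2) → Fin h) → IsComplete G h c →
    (φ₁ φ₂ : Fin (2 * h ∸ 2)) → φ₁ ≢ φ₂ →
    (∀ v → c v ≡ c φ₁ → v ≡ φ₁) →
    (∀ v → c v ≡ c φ₂ → v ≡ φ₂) →
    (∀ v → v ≢ φ₁ → v ≢ φ₂ →
      ∃[ w ] (w ≢ v × c w ≡ c v × (∀ u → c u ≡ c v → u ≡ v ⊎ u ≡ w))) →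
    (i : Fin h) → i ≢ c φ₁ → i ≢ c φ₂ →
    (∀ v → c v ≡ i → ∃[ u ] (u ≢ φ₁ × u ≢ φ₂ × Adj G v u)) →
    InducedP4 G (λ v → c v ≡ i ⊎ v ≡ φ₁ ⊎ v ≡ φ₂)
corollary1 _ _ G _ grundy3 _ c complete φ₁ φ₂ φ₁≢φ₂ single₁ single₂ pairs i i≢cφ₁ i≢cφ₂ hasOtherNeighbour =
  pairClassInducesP4 i i≢cφ₁ i≢cφ₂ classAtMostTwo hasOtherNeighbour
  where
  open SingletonClasses G c complete
  open TwoSingletons grundy3 single₁ single₂ φ₁≢φ₂

  classAtMostTwo : AtMostTwo (λ v → c v ≡ i)
  classAtMostTwo with proj₂ (proj₁ complete) i
  ... | a , ca with pairs a (λ { refl → i≢cφ₁ (sym ca) }) (λ { refl → i≢cφ₂ (sym ca) })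
  ...   | b , _ , _ , inPair = atMostTwo a b (λ u cu → inPair u (trans cu (sym ca)))
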